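{- Let $X$ be a finite set, $\mathcal{C}$ a set of partial characters on $X$, and $\mathcal{T}=(T,\phi)$ an $X$-tree that displays every character of $\mathcal{C}'\subseteq\mathcal{C}$. Suppose that $\mathcal{T}$ is free, ternary, and each edge of $T$ is distinguished by $\mathcal{C}'$. Then $\operatorname{int}(\mathcal{C},\mathcal{T})$ is uniquely representable.
   Context: An $X$-tree is a pair $\mathcal{T}=(T,\phi)$ where $T$ is a tree and $\phi:X\to V(T)$ is a map such that every node of $T$ of degree one or two lies in the image of $\phi$. For $A\subseteq X$, $\mathcal{T}(A)$ denotes the minimal subtree of $T$ containing $\phi(A)$. $\mathcal{T}$ is free if $\phi$ is a bijection onto the leaves of $T$, and ternary if every internal node of $T$ has degree three. A partial character on $X$ is a partition $\chi$ of a subset of $X$ into nonempty cells. $\mathcal{T}$ displays $\chi$ if for every two distinct cells $A,A'$ of $\chi$, $\mathcal{T}(A)$ and $\mathcal{T}(A')$ have no common node. An edge $uv$ of $T$ is distinguished by $\chi$ if $u$ is a node of $\mathcal{T}(A)$ and $v$ a node of $\mathcal{T}(A')$ for distinct cells $A,A'$ of $\chi$; an edge is distinguished by $\mathcal{C}'$ if it is distinguished by at least one character of $\mathcal{C}'$. The graph $\operatorname{int}(\mathcal{C},\mathcal{T})$ has vertex set $\{(A,\chi):\chi\in\mathcal{C}, A\text{ a cell of }\chi\}$, distinct vertices $(A,\chi),(A',\chi')$ being adjacent iff $\mathcal{T}(A)$ and $\mathcal{T}(A')$ share a node (it is chordal). A clique tree of a chordal graph $G$ is a pair $(T,\mathcal{K})$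 with $T$ a tree and $\mathcal{K}$ a bijection from $V(T)$ onto the maximal cliques of $G$ such that vertices $x,y$ are adjacent iff both lie in some $\mathcal{K}(v)$, and for each vertex $x$ the nodes $v$ with $x\in\mathcal{K}(v)$ induce a connected subtree. A chordal graph is uniquely representable if it has exactly one clique tree. -}

module Defs where

open import Data.Nat using (ℕ; _≤_; _≥_; suc; zero)
open import Data.Fin using (Fin)
open import Data.Fin.Subset using (Subset; _∈_; ∣_∣; Nonempty)
open import Data.Vec using (tabulate)
open import Data.Bool using (Bool; true; false)
open import Data.List using (List; []; _∷_; length)
open import Data.List.Relation.Unary.All using (All)
open import Data.List.Relation.Unary.Unique.Propositional using (Unique)
open import Data.Product using (Σ; Σ-syntax; ∃; _×_; proj₁; proj₂)
open import Function.Bundles using (_⇔_)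
open import Relation.Binary.PropositionalEquality using (_≡_; _≢_)
open import Relation.Nullary using (¬_)

Adj : ℕ → Set
Adj m = Fin m → Fin m → Bool

data Walk {m : ℕ} (E : Adj m) : Fin m → Fin m → Set where
  here : (v : Fin m) → Walk E v v
  step : {u w v : Fin m} → E u w ≡ true → Walk E w v → Walk E u v

verts : {m : ℕ} {E : Adj m} {u v : Fin m} → Walk E u v → List (Fin m)
verts (here v) = v Data.List.∷ []
verts {u = u} (step _ p) = u ∷ verts p

ConnectedIn : {m : ℕ} → Adj m → Subset m → Set
ConnectedIn {m} E S =
  (u v : Fin m) → u ∈ S → v ∈ S → Σ[ p ∈ Walk E u v ] All (_∈ S) (verts p)

HasCycle : {m : ℕ} → Adj m → Set
HasCycle {m} E =
  Σ[ u ∈ Fin m ] Σ[ v ∈ Fin m ] Σ[ p ∈ Walk E u v ]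
    (Unique (verts p) × (3 ≤ length (verts p)) × (E v u ≡ true))

record IsTree {m : ℕ} (E : Adj m) : Set where
  field
    nonempty  : 1 ≤ m
    irrefl    : (v : Fin m) → E v v ≡ false
    symmetric : (u v : Fin m) → E u v ≡ E v u
    connected : (u v : Fin m) → Walk E u v
    acyclic   : ¬ HasCycle E

degree : {m : ℕ} → Adj m → Fin m → ℕ
degree E v = ∣ tabulate (E v) ∣

record XTree (n : ℕ) : Set where
  field
    m      : ℕ
    E      : Adj m
    isTree : IsTree E
    φ      : Fin n → Fin m
    lowDeg : (v : Fin m) → degree E v ≤ 2 → Σ[ x ∈ Fin n ] φ x ≡ v

-- v is a node of the minimal subtree 𝒯(A): it lies in every connected
-- node set containing φ(A)
InSpan : {n : ℕ} (𝒯 : XTree n) → Subset n → Fin (XTree.m 𝒯) → Set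
InSpan 𝒯 A v =
  (S : Subset (XTree.m 𝒯)) → ((x : Fin _) → x ∈ A → XTree.φ 𝒯 x ∈ S) →
  ConnectedIn (XTree.E 𝒯) S → v ∈ S

Leaf : {n : ℕ} (𝒯 : XTree n) → Fin (XTree.m 𝒯) → Set
Leaf 𝒯 v = degree (XTree.E 𝒯) v ≡ 1

Free : {n : ℕ} → XTree n → Set
Free {n} 𝒯 =
  ((x y : Fin n) → XTree.φ 𝒯 x ≡ XTree.φ 𝒯 y → x ≡ y) ×
  ((v : Fin (XTree.m 𝒯)) → Leaf 𝒯 v ⇔ (Σ[ x ∈ Fin n ] XTree.φ 𝒯 x ≡ v))

Ternary : {n : ℕ} → XTree n → Set
Ternary 𝒯 = (v : Fin (XTree.m 𝒯)) → ¬ Leaf 𝒯 v → degree (XTree.E 𝒯) v ≡ 3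

-- partial characters: a partition of a subset of X into nonempty cells

record Character (n : ℕ) : Set where
  field
    k        : ℕ
    cell     : Fin k → Subset n
    nonempty : (i : Fin k) → Nonempty (cell i)
    disjoint : (i j : Fin k) → i ≢ j → (x : Fin n) → ¬ (x ∈ cell i × x ∈ cell j)

SamePartition : {n : ℕ} → Character n → Character n → Set
SamePartition χ χ' =
  ((i : Fin (Character.k χ)) → Σ[ j ∈ Fin (Character.k χ') ] Character.cell χ i ≡ Character.cell χ' j) ×
  ((j : Fin (Character.k χ')) → Σ[ i ∈ Fin (Character.k χ) ] Character.cell χ i ≡ Character.cell χ' j)

Displays : {n : ℕ} → XTree n → Character n → Set
Displays 𝒯 χ =
  (i j : Fin (Character.k χ)) → i ≢ j → (v : Fin (XTree.m 𝒯)) →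
  ¬ (InSpan 𝒯 (Character.cell χ i) v × InSpan 𝒯 (Character.cell χ j) v)

Distinguishes : {n : ℕ} (𝒯 : XTree n) → Character n → Fin (XTree.m 𝒯) → Fin (XTree.m 𝒯) → Set
Distinguishes 𝒯 χ u v =
  Σ[ i ∈ Fin (Character.k χ) ] Σ[ j ∈ Fin (Character.k χ) ]
    (i ≢ j × InSpan 𝒯 (Character.cell χ i) u × InSpan 𝒯 (Character.cell χ j) v)

-- the graph int(𝒞, 𝒯), 𝒞 = {C i | i : Fin c}

IntV : {n c : ℕ} → (Fin c → Character n) → Set
IntV {c = c} C = Σ[ i ∈ Fin c ] Fin (Character.k (C i))

cellOf : {n c : ℕ} (C : Fin c → Character n) → IntV C → Subset n
cellOf C p = Character.cell (C (proj₁ p)) (proj₂ p)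

IntAdj : {n c : ℕ} → XTree n → (C : Fin c → Character n) → IntV C → IntV C → Set
IntAdj 𝒯 C p q =
  p ≢ q × Σ[ v ∈ Fin (XTree.m 𝒯) ] (InSpan 𝒯 (cellOf C p) v × InSpan 𝒯 (cellOf C q) v)

module _ {V : Set} (G : V → V → Set) where

  IsClique : (V → Bool) → Set
  IsClique K = (x y : V) → K x ≡ true → K y ≡ true → x ≢ y → G x y

  IsMaxClique : (V → Bool) → Set
  IsMaxClique K = IsClique K ×
    ((K' : V → Bool) → IsClique K' → ((x : V) → K x ≡ true → K' x ≡ true) →
     (x : V) → K' x ≡ true → K x ≡ true)

  record CliqueTree : Set where
    field
      p          : ℕ
      E          : Adj p
      isTree     : IsTree E
      K          : Fin p → V → Bool
      maximal    : (t : Fin p) → IsMaxClique (K t)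
      injective  : (s t : Fin p) → ((x : V) → K s x ≡ K t x) → s ≡ t
      surjective : (Q : V → Bool) → IsMaxClique Q → Σ[ t ∈ Fin p ] ((x : V) → K t x ≡ Q x)
      adjacency  : (x y : V) → x ≢ y → G x y ⇔ (Σ[ t ∈ Fin p ] (K t x ≡ true × K t y ≡ true))
      subtree    : (x : V) → ConnectedIn E (tabulate (λ t → K t x))

  -- exactly one clique tree: one exists, and any two clique trees, viewed
  -- as trees on the set of maximal cliques of G, have the same edges
  UniquelyRepresentable : Set
  UniquelyRepresentable = CliqueTree ×
    ((A B : CliqueTree) →
     (s₁ t₁ : Fin (CliqueTree.p A)) (s₂ t₂ : Fin (CliqueTree.p B)) →
     ((x : V) → CliqueTree.K A s₁ x ≡ CliqueTree.K B s₂ x) →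
     ((x : V) → CliqueTree.K A t₁ x ≡ CliqueTree.K B t₂ x) →
     CliqueTree.E A s₁ t₁ ≡ CliqueTree.E B s₂ t₂)

-- The tree 𝒯 itself is a clique tree of int(𝒞, 𝒯) when node t carries the set K t of cells
-- whose subtree passes through t: every clique lies in some K t by the Helly property of
-- subtrees, and since every edge is distinguished, distinct nodes carry distinct maximal cliques.
-- For uniqueness, freeness and ternarity give, for every edge uv and node w ∉ {u, v}, a cell
-- whose subtree contains u and v but not w. In any other clique tree B, nodes correspond to
-- nodes of 𝒯 through their cliques, and by the subtree property of that cell the B-path between
-- the nodes of u and v has no inner node. So edges of 𝒯 are edges of B, and an injective
-- edge-preserving map between trees also reflects edges.
module Submission where

open import Defs
open import Data.Nat using (ℕ; _≤_; s≤s; z≤n)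
open import Data.Nat.Properties using (≤-trans)
open import Data.Fin using (Fin; fromℕ<)
open import Data.Fin.Properties using (_≟_; any?)
open import Data.Fin.Subset using (Subset; _∈_; ∣_∣; _-_)
open import Data.Fin.Subset.Properties using (x∈p⇒∣p-x∣<∣p∣; x∈p∧x≢y⇒x∈p-y)
  renaming (_∈?_ to _∈ₛ?_)
open import Data.Vec using (tabulate)
open import Data.Vec.Properties using (lookup∘tabulate; []=⇒lookup; lookup⇒[]=)
open import Data.Bool using (Bool; true; false)
open import Data.Bool.Properties using (⇔→≡; ¬-not) renaming (_≟_ to _≟ᵇ_)
open import Data.List using (List; []; _∷_; length; map; concatMap; allFin; filter)
open import Data.List.Properties using (length-map)
open import Data.List.Relation.Unary.Any as Any using (here; there)
open import Data.List.Relation.Unary.All as All using (All; []; _∷_)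
open import Data.List.Relation.Unary.All.Properties using (¬Any⇒All¬; All¬⇒¬Any)
open import Data.List.Relation.Unary.AllPairs using ([]; _∷_)
open import Data.List.Relation.Unary.Unique.Propositional using (Unique)
import Data.List.Relation.Unary.Unique.Propositional.Properties as Unique
open import Data.List.Relation.Binary.Subset.Propositional using () renaming (_⊆_ to _⊆ₗ_)
open import Data.List.Membership.Propositional using () renaming (_∈_ to _∈ₗ_)
open import Data.List.Membership.Propositional.Properties
  using (∈-filter⁺; ∈-filter⁻; ∈-allFin; ∈-concatMap⁺; ∈-map⁺)
open import Data.Product using (Σ-syntax; _×_; _,_; proj₁; proj₂)
open import Data.Product.Properties using (≡-dec)
open import Data.Sum using (_⊎_; inj₁; inj₂)
open import Data.Empty using (⊥; ⊥-elim)
open import Function using (_∘_)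
open import Function.Bundles using (mk⇔; Equivalence)
open import Relation.Binary.PropositionalEquality
open import Relation.Nullary using (¬_; Dec; yes; no; does)
open import Relation.Nullary.Decidable using (_×-dec_; dec-true)

b≡true⇒b≢false : {b : Bool} → b ≡ true → b ≢ false
b≡true⇒b≢false refl ()

module Walks {m : ℕ} {E : Adj m} where

  infixr 5 _++ʷ_
  _++ʷ_ : {u w v : Fin m} → Walk E u w → Walk E w v → Walk E u v
  here _   ++ʷ q = q
  step e p ++ʷ q = step e (p ++ʷ q)

  IsPath : {u v : Fin m} → Walk E u v → Set
  IsPath p = Unique (verts p)

  start∈verts : {u v : Fin m} (p : Walk E u v) → u ∈ₗ verts p
  start∈verts (here _)   = here refl
  start∈verts (step _ _) = here refl

  end∈verts : {u v : Fin m} (p : Walk E u v) → v ∈ₗ verts p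
  end∈verts (here _)   = here refl
  end∈verts (step _ p) = there (end∈verts p)

  ∈-++ʷ⁺ˡ : {u w v : Fin m} (p : Walk E u w) (q : Walk E w v) → verts p ⊆ₗ verts (p ++ʷ q)
  ∈-++ʷ⁺ˡ (here _)   q (here refl) = start∈verts q
  ∈-++ʷ⁺ˡ (step _ p) q (here refl) = here refl
  ∈-++ʷ⁺ˡ (step _ p) q (there z∈) = there (∈-++ʷ⁺ˡ p q z∈)

  ∈-++ʷ⁺ʳ : {u w v : Fin m} (p : Walk E u w) (q : Walk E w v) → verts q ⊆ₗ verts (p ++ʷ q)
  ∈-++ʷ⁺ʳ (here _)   q z∈ = z∈
  ∈-++ʷ⁺ʳ (step _ p) q z∈ = there (∈-++ʷ⁺ʳ p q z∈)

  ∈-++ʷ⁻ : {u w v z : Fin m} (p : Walk E u w) (q : Walk E w v) →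
           z ∈ₗ verts (p ++ʷ q) → z ∈ₗ verts p ⊎ z ∈ₗ verts q
  ∈-++ʷ⁻ (here _)   q z∈          = inj₂ z∈
  ∈-++ʷ⁻ (step _ p) q (here refl) = inj₁ (here refl)
  ∈-++ʷ⁻ (step _ p) q (there z∈) with ∈-++ʷ⁻ p q z∈
  ... | inj₁ z∈p = inj₁ (there z∈p)
  ... | inj₂ z∈q = inj₂ z∈q

  IsPath-++ʷ⁻ˡ : {u w v : Fin m} (p : Walk E u w) (q : Walk E w v) → IsPath (p ++ʷ q) → IsPath p
  IsPath-++ʷ⁻ˡ (here _)   q _ = [] ∷ []
  IsPath-++ʷ⁻ˡ (step _ p) q (u∉ ∷ path) =
    All.tabulate (All.lookup u∉ ∘ ∈-++ʷ⁺ˡ p q) ∷ IsPath-++ʷ⁻ˡ p q path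

  IsPath-++ʷ⁻ʳ : {u w v : Fin m} (p : Walk E u w) (q : Walk E w v) → IsPath (p ++ʷ q) → IsPath q
  IsPath-++ʷ⁻ʳ (here _)   q path       = path
  IsPath-++ʷ⁻ʳ (step _ p) q (_ ∷ path) = IsPath-++ʷ⁻ʳ p q path

  split-at : {u v w : Fin m} (p : Walk E u v) → w ∈ₗ verts p →
             Σ[ q ∈ Walk E u w ] Σ[ r ∈ Walk E w v ] p ≡ q ++ʷ r
  split-at (here v)   (here refl) = here v , here v , refl
  split-at (step e p) (here refl) = here _ , step e p , refl
  split-at (step e p) (there w∈) with split-at p w∈
  ... | q , r , refl = step e q , r , refl

  first-step : {u v : Fin m} → u ≢ v → (p : Walk E u v) → Σ[ a ∈ Fin m ] (E u a ≡ true × a ∈ₗ verts p)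
  first-step u≢v (here _)   = ⊥-elim (u≢v refl)
  first-step u≢v (step e p) = _ , e , there (start∈verts p)

  two-vertices⇒edge : {u v : Fin m} (p : Walk E u v) → length (verts p) ≡ 2 → E u v ≡ true
  two-vertices⇒edge (step e (here _))         _  = e
  two-vertices⇒edge (step _ (step _ (here _))) ()
  two-vertices⇒edge (step _ (step _ (step _ _))) ()

  non-adjacent⇒inner-vertex : {u v : Fin m} (p : Walk E u v) → IsPath p → u ≢ v → E u v ≡ false →
                               Σ[ w ∈ Fin m ] (w ∈ₗ verts p × w ≢ u × w ≢ v)
  non-adjacent⇒inner-vertex (here _)                   _          u≢u _  = ⊥-elim (u≢u refl)
  non-adjacent⇒inner-vertex (step e (here _))          _          _   ¬e = ⊥-elim (b≡true⇒b≢false e ¬e)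
  non-adjacent⇒inner-vertex (step e (step e′ p)) (u∉ ∷ _) _ ¬e =
    _ , there (here refl) , (λ { refl → All¬⇒¬Any u∉ (here refl) }) , (λ { refl → b≡true⇒b≢false e ¬e })

open Walks

module Tree {m : ℕ} {E : Adj m} (tree : IsTree E) where
  open IsTree tree
  open import Data.List.Membership.DecPropositional (_≟_ {m}) using (_∈?_)

  flip-edge : {u v : Fin m} → E u v ≡ true → E v u ≡ true
  flip-edge {u} {v} e = trans (symmetric v u) e

  adjacent⇒≢ : {u v : Fin m} → E u v ≡ true → u ≢ v
  adjacent⇒≢ {u} e refl = b≡true⇒b≢false e (irrefl u)

  reverse : {u v : Fin m} → Walk E u v → Walk E v u
  reverse (here v)   = here v
  reverse (step e p) = reverse p ++ʷ step (flip-edge e) (here _)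

  ∈-reverse⁻ : {u v : Fin m} (p : Walk E u v) → verts (reverse p) ⊆ₗ verts p
  ∈-reverse⁻ (here _)   z∈ = z∈
  ∈-reverse⁻ (step e p) z∈ with ∈-++ʷ⁻ (reverse p) (step (flip-edge e) (here _)) z∈
  ... | inj₁ z∈p                 = there (∈-reverse⁻ p z∈p)
  ... | inj₂ (here refl)         = there (start∈verts p)
  ... | inj₂ (there (here refl)) = here refl

  paths-unique : {u v : Fin m} (p q : Walk E u v) → IsPath p → IsPath q → verts p ≡ verts q
  paths-unique (here _) (here _)   _ _          = refl
  paths-unique (here _) (step _ q) _ (u∉ ∷ _)   = ⊥-elim (All¬⇒¬Any u∉ (end∈verts q))
  paths-unique (step {w = a} e p) q (u∉ ∷ p-path) q-path with a ∈? verts q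
  ... | no a∉q =
    ⊥-elim (All¬⇒¬Any u∉ (subst (_ ∈ₗ_)
      (sym (paths-unique p (step (flip-edge e) q) p-path (¬Any⇒All¬ _ a∉q ∷ q-path)))
      (there (start∈verts q))))
  ... | yes a∈q with split-at q a∈q
  ...   | here _ , _ , refl = ⊥-elim (All¬⇒¬Any u∉ (start∈verts p))
  ...   | step e₁ (here _) , r , refl =
    cong (_ ∷_) (paths-unique p r p-path (IsPath-++ʷ⁻ʳ (step e₁ (here _)) r q-path))
  ...   | step e₁ (step e₂ s) , r , refl =
    -- q runs from u to a in at least two steps; closed by the edge a u it is a cycle.
    ⊥-elim (acyclic (_ , a , step e₁ (step e₂ s) , IsPath-++ʷ⁻ˡ (step e₁ (step e₂ s)) r q-path ,
                     s≤s (s≤s (verts-nonempty s)) , flip-edge e))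
    where
    verts-nonempty : {u v : Fin m} (p : Walk E u v) → 1 ≤ length (verts p)
    verts-nonempty (here _)   = s≤s z≤n
    verts-nonempty (step _ _) = s≤s z≤n

  walk⇒path : {u v : Fin m} (w : Walk E u v) → Σ[ p ∈ Walk E u v ] (IsPath p × verts p ⊆ₗ verts w)
  walk⇒path (here v) = here v , [] ∷ [] , λ z∈ → z∈
  walk⇒path (step {u} e w) with walk⇒path w
  ... | p , p-path , p⊆w with u ∈? verts p
  ...   | no u∉p = step e p , ¬Any⇒All¬ _ u∉p ∷ p-path ,
                   λ { (here refl) → here refl ; (there z∈) → there (p⊆w z∈) }
  ...   | yes u∈p with split-at p u∈p
  ...     | q , r , refl = r , IsPath-++ʷ⁻ʳ q r p-path , there ∘ p⊆w ∘ ∈-++ʷ⁺ʳ q r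

  path⊆walk : {u v : Fin m} (p : Walk E u v) → IsPath p → (w : Walk E u v) → verts p ⊆ₗ verts w
  path⊆walk p p-path w {z} z∈p with walk⇒path w
  ... | q , q-path , q⊆w = q⊆w (subst (z ∈ₗ_) (paths-unique p q p-path q-path) z∈p)

  path : (u v : Fin m) → Walk E u v
  path u v = proj₁ (walk⇒path (connected u v))

  path-isPath : (u v : Fin m) → IsPath (path u v)
  path-isPath u v = proj₁ (proj₂ (walk⇒path (connected u v)))

  inner-vertex-neighbours : {u v z : Fin m} (p : Walk E u v) → IsPath p → z ∈ₗ verts p → z ≢ u → z ≢ v →
    Σ[ a ∈ Fin m ] Σ[ b ∈ Fin m ] (E z a ≡ true × E z b ≡ true × a ≢ b × a ∈ₗ verts p × b ∈ₗ verts p)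
  inner-vertex-neighbours (here _)   _ (here refl) _ z≢v = ⊥-elim (z≢v refl)
  inner-vertex-neighbours (step _ _) _ (here refl) z≢u _ = ⊥-elim (z≢u refl)
  inner-vertex-neighbours (step _ (here _)) _ (there (here refl)) _ z≢v = ⊥-elim (z≢v refl)
  inner-vertex-neighbours (step e (step e′ p)) (u∉ ∷ _) (there (here refl)) _ _ =
    _ , _ , flip-edge e , e′ , (λ { refl → All¬⇒¬Any u∉ (there (start∈verts p)) }) ,
    here refl , there (there (start∈verts p))
  inner-vertex-neighbours (step e (step e′ p)) (_ ∷ w∉ ∷ p-path) (there (there z∈)) _ z≢v
    with inner-vertex-neighbours (step e′ p) (w∉ ∷ p-path) (there z∈) (λ { refl → All¬⇒¬Any w∉ z∈ }) z≢v
  ... | a , b , ea , eb , a≢b , a∈ , b∈ = a , b , ea , eb , a≢b , there a∈ , there b∈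

  Connected : (Fin m → Set) → Set
  Connected A = (u v : Fin m) → A u → A v → Σ[ p ∈ Walk E u v ] All A (verts p)

  path-within : {A : Fin m → Set} → Connected A →
                {u v : Fin m} (p : Walk E u v) → IsPath p → A u → A v → All A (verts p)
  path-within A-connected p p-path Au Av with A-connected _ _ Au Av
  ... | w , A-w = All.tabulate (All.lookup A-w ∘ path⊆walk p p-path w)

  module _ {A B : Fin m → Set} (A-connected : Connected A) (B-connected : Connected B) where

    path-within-∪ : {u r v : Fin m} (p : Walk E u v) → IsPath p → B u → B r → A r → A v →
                    All (λ z → A z ⊎ B z) (verts p)
    path-within-∪ p p-path Bu Br Ar Av with B-connected _ _ Bu Br | A-connected _ _ Ar Av
    ... | w₁ , B-w₁ | w₂ , A-w₂ = All.tabulate (in-A∪B ∘ path⊆walk p p-path (w₁ ++ʷ w₂))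
      where
      in-A∪B : {z : Fin m} → z ∈ₗ verts (w₁ ++ʷ w₂) → A z ⊎ B z
      in-A∪B z∈ with ∈-++ʷ⁻ w₁ w₂ z∈
      ... | inj₁ z∈w₁ = inj₂ (All.lookup B-w₁ z∈w₁)
      ... | inj₂ z∈w₂ = inj₁ (All.lookup A-w₂ z∈w₂)

    no-crossing-edge : {r u v : Fin m} → A r → B r → B u → ¬ A u → A v → ¬ B v → E u v ≡ true → ⊥
    no-crossing-edge {r} {u} {v} Ar Br Bu ¬Au Av ¬Bv e with v ∈? verts (path u r)
    ... | yes v∈ = ¬Bv (All.lookup (path-within B-connected (path u r) (path-isPath u r) Bu Br) v∈)
    ... | no v∉ = ¬Au (All.lookup
            (path-within A-connected (step (flip-edge e) (path u r)) (¬Any⇒All¬ _ v∉ ∷ path-isPath u r) Av Ar)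
            (there (start∈verts (path u r))))

    walk-meets-∩ : (A? : ∀ z → Dec (A z)) (B? : ∀ z → Dec (B z)) {r u v : Fin m} → A r → B r →
                   (p : Walk E u v) → All (λ z → A z ⊎ B z) (verts p) → B u → A v →
                   Σ[ z ∈ Fin m ] (z ∈ₗ verts p × A z × B z)
    walk-meets-∩ A? B? Ar Br (here v) _ Bv Av = v , here refl , Av , Bv
    walk-meets-∩ A? B? Ar Br (step {u} {w} e p) (_ ∷ A∪B) Bu Av with A? u | B? w
    ... | yes Au | _ = u , here refl , Au , Bu
    ... | no ¬Au | yes Bw with walk-meets-∩ A? B? Ar Br p A∪B Bw Av
    ...   | z , z∈ , Az , Bz = z , there z∈ , Az , Bz
    walk-meets-∩ A? B? Ar Br (step {u} {w} e p) (_ ∷ A∪B) Bu Av | no ¬Au | no ¬Bw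
      with All.lookup A∪B (start∈verts p)
    ... | inj₁ Aw = ⊥-elim (no-crossing-edge Ar Br Bu ¬Au Aw ¬Bw e)
    ... | inj₂ Bw = ⊥-elim (¬Bw Bw)

  helly₃ : {A B D : Fin m → Set} → (∀ z → Dec (A z)) → (∀ z → Dec (B z)) →
           Connected A → Connected B → Connected D → {a b d : Fin m} →
           A a → B a → B b → D b → A d → D d → Σ[ z ∈ Fin m ] (A z × B z × D z)
  helly₃ A? B? A-connected B-connected D-connected {a} {b} {d} Aa Ba Bb Db Ad Dd
    with walk-meets-∩ A-connected B-connected A? B? Aa Ba (path b d)
           (path-within-∪ A-connected B-connected (path b d) (path-isPath b d) Bb Ba Aa Ad) Bb Ad
  ... | z , z∈ , Az , Bz =
    z , Az , Bz , All.lookup (path-within D-connected (path b d) (path-isPath b d) Db Dd) z∈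

  module _ {ι : Set} (A : ι → Fin m → Set) (A? : ∀ i t → Dec (A i t))
           (A-connected : ∀ i → Connected (A i)) where

    ⋂ : List ι → Fin m → Set
    ⋂ K t = All (λ i → A i t) K

    ⋂-connected : (K : List ι) → Connected (⋂ K)
    ⋂-connected []      u v _ _ = connected u v , All.universal (λ _ → []) _
    ⋂-connected (i ∷ K) u v (Aiu ∷ Ku) (Aiv ∷ Kv) =
      path u v , All.zipWith (λ (Ai , K) → Ai ∷ K)
        (path-within (A-connected i) (path u v) (path-isPath u v) Aiu Aiv ,
         path-within (⋂-connected K) (path u v) (path-isPath u v) Ku Kv)

    helly : (L : List ι) → (∀ {i j} → i ∈ₗ L → j ∈ₗ L → Σ[ t ∈ Fin m ] (A i t × A j t)) →
            Σ[ t ∈ Fin m ] ⋂ L t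
    helly []        _    = fromℕ< nonempty , []
    helly L@(_ ∷ _) meet = let t , ⋂Lt , _ = meets-⋂ L (λ i∈ → i∈) (here refl) in t , ⋂Lt
      where
      -- The intersection over a sublist K meets every member of L; adding one more member to K
      -- is the Helly property for three subtrees.
      meets-⋂ : (K : List ι) → K ⊆ₗ L → {j : ι} → j ∈ₗ L → Σ[ t ∈ Fin m ] (⋂ K t × A j t)
      meets-⋂ []      _    j∈ = let t , Ajt , _ = meet j∈ j∈ in t , [] , Ajt
      meets-⋂ (k ∷ K) K⊆L j∈ =
        let a , ⋂Ka , Aka = meets-⋂ K (K⊆L ∘ there) (K⊆L (here refl))
            b , Akb , Ajb  = meet (K⊆L (here refl)) j∈
            d , ⋂Kd , Ajd = meets-⋂ K (K⊆L ∘ there) j∈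
            z , ⋂Kz , Akz , Ajz = helly₃ (λ t → All.all? (λ i → A? i t) K) (A? k)
                                    (⋂-connected K) (A-connected k) (A-connected _) ⋂Ka Aka Akb Ajb ⋂Kd Ajd
        in z , Akz ∷ ⋂Kz , Ajz

module _ {m₁ m₂ : ℕ} {E₁ : Adj m₁} {E₂ : Adj m₂} (tree₁ : IsTree E₁) (tree₂ : IsTree E₂)
         (f : Fin m₁ → Fin m₂) (f-injective : {u v : Fin m₁} → f u ≡ f v → u ≡ v)
         (f-edge : {u v : Fin m₁} → E₁ u v ≡ true → E₂ (f u) (f v) ≡ true) where

  map-walk : {u v : Fin m₁} → Walk E₁ u v → Walk E₂ (f u) (f v)
  map-walk (here v)   = here (f v)
  map-walk (step e p) = step (f-edge e) (map-walk p)

  verts-map-walk : {u v : Fin m₁} (p : Walk E₁ u v) → verts (map-walk p) ≡ map f (verts p)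
  verts-map-walk (here v)   = refl
  verts-map-walk (step e p) = cong (_ ∷_) (verts-map-walk p)

  injective-homomorphism-reflects-edges : {u v : Fin m₁} → E₂ (f u) (f v) ≡ true → E₁ u v ≡ true
  injective-homomorphism-reflects-edges {u} {v} e = two-vertices⇒edge p (begin
      length (verts p)             ≡⟨ length-map f (verts p) ⟨
      length (map f (verts p))     ≡⟨ cong length (verts-map-walk p) ⟨
      length (verts (map-walk p))  ≡⟨ cong length (Tree.paths-unique tree₂ (map-walk p) edge image-isPath edge-isPath) ⟩
      length (verts edge)          ∎)
    where
    open ≡-Reasoning
    p : Walk E₁ u v
    p = Tree.path tree₁ u v
    image-isPath : IsPath (map-walk p)
    image-isPath = subst Unique (sym (verts-map-walk p)) (Unique.map⁺ f-injective (Tree.path-isPath tree₁ u v))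
    edge : Walk E₂ (f u) (f v)
    edge = step e (here (f v))
    edge-isPath : IsPath edge
    edge-isPath = (Tree.adjacent⇒≢ tree₂ e ∷ []) ∷ [] ∷ []

Unique⇒length≤∣∣ : {m : ℕ} (S : Subset m) (xs : List (Fin m)) → Unique xs → All (_∈ S) xs → length xs ≤ ∣ S ∣
Unique⇒length≤∣∣ S []       _              _            = z≤n
Unique⇒length≤∣∣ S (x ∷ xs) (x∉ ∷ xs-uniq) (x∈S ∷ xs⊆S) =
  ≤-trans (s≤s (Unique⇒length≤∣∣ (S - x) xs xs-uniq
                 (All.zipWith (λ (y∈S , x≢y) → x∈p∧x≢y⇒x∈p-y y∈S (x≢y ∘ sym)) (xs⊆S , x∉))))
          (x∈p⇒∣p-x∣<∣p∣ x∈S)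

∈-tabulate⁺ : {m : ℕ} (f : Fin m → Bool) {t : Fin m} → f t ≡ true → t ∈ tabulate f
∈-tabulate⁺ f {t} ft = lookup⇒[]= t (tabulate f) (trans (lookup∘tabulate f t) ft)

∈-tabulate⁻ : {m : ℕ} (f : Fin m → Bool) {t : Fin m} → t ∈ tabulate f → f t ≡ true
∈-tabulate⁻ f {t} t∈ = trans (sym (lookup∘tabulate f t)) ([]=⇒lookup t∈)

neighbours-length≤degree : {m : ℕ} (E : Adj m) (v : Fin m) (xs : List (Fin m)) → Unique xs →
                           All (λ a → E v a ≡ true) xs → length xs ≤ degree E v
neighbours-length≤degree E v xs xs-uniq adjacent =
  Unique⇒length≤∣∣ (tabulate (E v)) xs xs-uniq (All.map (∈-tabulate⁺ (E v)) adjacent)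

module IntersectionGraph {n c : ℕ} (C : Fin c → Character n) (𝒯 : XTree n) where
  open XTree 𝒯
  open IsTree isTree
  open Tree isTree
  open import Data.List.Membership.DecPropositional (_≟_ {m}) using (_∈?_)

  V : Set
  V = IntV C

  G : V → V → Set
  G = IntAdj 𝒯 C

  anchor : V → Fin n
  anchor x = proj₁ (Character.nonempty (C (proj₁ x)) (proj₂ x))

  anchor∈cell : (x : V) → anchor x ∈ cellOf C x
  anchor∈cell x = proj₂ (Character.nonempty (C (proj₁ x)) (proj₂ x))

  -- 𝒯(A) as the union of the paths from one fixed leaf φ(a₀), a₀ ∈ A, to the leaves φ(y), y ∈ A;
  -- unlike InSpan this description is decidable.
  Span : V → Fin m → Set
  Span x t = Σ[ y ∈ Fin n ] (y ∈ cellOf C x × t ∈ₗ verts (path (φ (anchor x)) (φ y)))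

  span? : (x : V) (t : Fin m) → Dec (Span x t)
  span? x t = any? (λ y → (y ∈ₛ? cellOf C x) ×-dec (t ∈? verts (path (φ (anchor x)) (φ y))))

  anchor-in-span : (x : V) → Span x (φ (anchor x))
  anchor-in-span x = anchor x , anchor∈cell x , start∈verts (path _ _)

  leaf-in-span : (x : V) {y : Fin n} → y ∈ cellOf C x → Span x (φ y)
  leaf-in-span x {y} y∈ = y , y∈ , end∈verts (path _ _)

  span-connected : (x : V) → Connected (Span x)
  span-connected x u v (y , y∈ , u∈) (y′ , y′∈ , v∈)
    with split-at (path (φ (anchor x)) (φ y)) u∈ | split-at (path (φ (anchor x)) (φ y′)) v∈
  ... | q₁ , q₂ , eq | r₁ , r₂ , eq′ = reverse q₁ ++ʷ r₁ , All.tabulate in-span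
    where
    in-span : {z : Fin m} → z ∈ₗ verts (reverse q₁ ++ʷ r₁) → Span x z
    in-span z∈ with ∈-++ʷ⁻ (reverse q₁) r₁ z∈
    ... | inj₁ z∈q₁ = y  , y∈  , subst (_ ∈ₗ_) (cong verts (sym eq))  (∈-++ʷ⁺ˡ q₁ q₂ (∈-reverse⁻ q₁ z∈q₁))
    ... | inj₂ z∈r₁ = y′ , y′∈ , subst (_ ∈ₗ_) (cong verts (sym eq′)) (∈-++ʷ⁺ˡ r₁ r₂ z∈r₁)

  K : Fin m → V → Bool
  K t x = does (span? x t)

  K-sound : {t : Fin m} {x : V} → K t x ≡ true → Span x t
  K-sound {t} {x} Ktx with span? x t
  ... | yes Sxt = Sxt

  K-complete : {t : Fin m} {x : V} → Span x t → K t x ≡ true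
  K-complete {t} {x} = dec-true (span? x t)

  K-subtree : (x : V) → ConnectedIn E (tabulate (λ t → K t x))
  K-subtree x u v u∈ v∈ with span-connected x u v (K-sound (∈-tabulate⁻ _ u∈)) (K-sound (∈-tabulate⁻ _ v∈))
  ... | w , in-span = w , All.map (∈-tabulate⁺ (λ t → K t x) ∘ K-complete) in-span

  Span⇒InSpan : {x : V} {t : Fin m} → Span x t → InSpan 𝒯 (cellOf C x) t
  Span⇒InSpan {x} (y , y∈ , t∈) S φA⊆S S-connected =
    All.lookup (path-within S-connected (path _ _) (path-isPath _ _)
                  (φA⊆S (anchor x) (anchor∈cell x)) (φA⊆S y y∈)) t∈

  InSpan⇒Span : {x : V} {t : Fin m} → InSpan 𝒯 (cellOf C x) t → Span x t
  InSpan⇒Span {x} t∈𝒯 = K-sound (∈-tabulate⁻ _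
    (t∈𝒯 _ (λ y y∈ → ∈-tabulate⁺ _ (K-complete (leaf-in-span x y∈))) (K-subtree x)))

  distinct-neighbours⇒¬Leaf : {v a b : Fin m} → E v a ≡ true → E v b ≡ true → a ≢ b → ¬ Leaf 𝒯 v
  distinct-neighbours⇒¬Leaf {v} ea eb a≢b leaf
    with subst (2 ≤_) leaf (neighbours-length≤degree E v (_ ∷ _ ∷ []) ((a≢b ∷ []) ∷ [] ∷ []) (ea ∷ eb ∷ []))
  ... | s≤s ()

  K-clique : (t : Fin m) → IsClique G (K t)
  K-clique t x y Ktx Kty x≢y = x≢y , t , Span⇒InSpan (K-sound Ktx) , Span⇒InSpan (K-sound Kty)

  all-cells : List V
  all-cells = concatMap (λ i → map (i ,_) (allFin (Character.k (C i)))) (allFin c)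

  ∈-all-cells : (x : V) → x ∈ₗ all-cells
  ∈-all-cells (i , j) =
    ∈-concatMap⁺ _ (Any.map (λ { refl → ∈-map⁺ (i ,_) (∈-allFin j) }) (∈-allFin i))

  clique⊆K : (Q : V → Bool) → IsClique G Q → Σ[ t ∈ Fin m ] ((x : V) → Q x ≡ true → K t x ≡ true)
  clique⊆K Q Q-clique =
    let t , in-all = helly Span span? span-connected members meet
    in t , λ x Qx → K-complete (All.lookup in-all (∈-filter⁺ Q? (∈-all-cells x) Qx))
    where
    Q? : (x : V) → Dec (Q x ≡ true)
    Q? x = Q x ≟ᵇ true

    members : List V
    members = filter Q? all-cells

    member⇒Q : {x : V} → x ∈ₗ members → Q x ≡ true
    member⇒Q = proj₂ ∘ ∈-filter⁻ Q? {xs = all-cells}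

    meet : {x y : V} → x ∈ₗ members → y ∈ₗ members → Σ[ t ∈ Fin m ] (Span x t × Span y t)
    meet {x} {y} x∈ y∈ with ≡-dec _≟_ _≟_ x y
    ... | yes refl = φ (anchor x) , anchor-in-span x , anchor-in-span x
    ... | no x≢y with Q-clique x y (member⇒Q x∈) (member⇒Q y∈) x≢y
    ...   | _ , t , t∈x , t∈y = t , InSpan⇒Span t∈x , InSpan⇒Span t∈y

  module _ (edge-separated : {u v : Fin m} → E u v ≡ true → Σ[ x ∈ V ] (Span x u × ¬ Span x v)) where

    -- y separates t from the first node a on the way from t to x's subtree; meeting that
    -- subtree would force an edge (t a) from y's subtree alone into x's subtree alone.
    disjoint-cell-at : {x : V} {t : Fin m} → ¬ Span x t →
                       Σ[ y ∈ V ] (Span y t × ((r : Fin m) → Span x r → ¬ Span y r))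
    disjoint-cell-at {x} {t} ¬Sxt with first-step (λ { refl → ¬Sxt (anchor-in-span x) }) (path t (φ (anchor x)))
    ... | a , e , a∈ with edge-separated e
    ...   | y , Syt , ¬Sya = y , Syt , disjoint
      where
      disjoint : (r : Fin m) → Span x r → ¬ Span y r
      disjoint r Sxr Syr
        with All.lookup (path-within-∪ (span-connected x) (span-connected y) (path _ _) (path-isPath _ _)
                           Syt Syr Sxr (anchor-in-span x)) a∈
      ... | inj₁ Sxa = no-crossing-edge (span-connected x) (span-connected y) Sxr Syr Syt ¬Sxt Sxa ¬Sya e
      ... | inj₂ Sya = ¬Sya Sya

    K-maximal : (t : Fin m) → IsMaxClique G (K t)
    K-maximal t = K-clique t , maximal
      where
      maximal : (Q : V → Bool) → IsClique G Q → ((x : V) → K t x ≡ true → Q x ≡ true) →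
                (x : V) → Q x ≡ true → K t x ≡ true
      maximal Q Q-clique Kt⊆Q x Qx with span? x t
      ... | yes _   = refl
      ... | no ¬Sxt with disjoint-cell-at ¬Sxt
      ...   | y , Syt , disjoint
        with Q-clique x y Qx (Kt⊆Q y (K-complete Syt)) (λ { refl → ¬Sxt Syt })
      ...     | _ , r , r∈x , r∈y = ⊥-elim (disjoint r (InSpan⇒Span r∈x) (InSpan⇒Span r∈y))

    K-injective : (s t : Fin m) → ((x : V) → K s x ≡ K t x) → s ≡ t
    K-injective s t Ks≗Kt with s ≟ t
    ... | yes s≡t = s≡t
    ... | no s≢t with first-step s≢t (path s t)
    ...   | a , e , a∈ with edge-separated e
    ...     | y , Sys , ¬Sya = ⊥-elim (¬Sya (All.lookup
              (path-within (span-connected y) (path s t) (path-isPath s t) Sys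
                (K-sound (trans (sym (Ks≗Kt y)) (K-complete Sys)))) a∈))

    K-surjective : (Q : V → Bool) → IsMaxClique G Q → Σ[ t ∈ Fin m ] ((x : V) → K t x ≡ Q x)
    K-surjective Q (Q-clique , Q-maximal) with clique⊆K Q Q-clique
    ... | t , Q⊆Kt = t , λ x → ⇔→≡ (mk⇔ (Q-maximal (K t) (K-clique t) Q⊆Kt x) (Q⊆Kt x))

    cliqueTree : CliqueTree G
    cliqueTree = record
      { p          = m
      ; E          = E
      ; isTree     = isTree
      ; K          = K
      ; maximal    = K-maximal
      ; injective  = K-injective
      ; surjective = K-surjective
      ; adjacency  = λ x y x≢y → mk⇔
          (λ { (_ , t , t∈x , t∈y) → t , K-complete (InSpan⇒Span t∈x) , K-complete (InSpan⇒Span t∈y) })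
          (λ { (t , Ktx , Kty) → K-clique t x y Ktx Kty x≢y })
      ; subtree    = K-subtree
      }

    module _ (leaf-φ : (y : Fin n) → Leaf 𝒯 (φ y)) (ternary : Ternary 𝒯) where

      inner-node-of-span : {x : V} {t : Fin m} → Span x t → ¬ Leaf 𝒯 t →
        Σ[ a ∈ Fin m ] Σ[ b ∈ Fin m ] (E t a ≡ true × E t b ≡ true × a ≢ b × Span x a × Span x b)
      inner-node-of-span {x} (y , y∈ , t∈) ¬leaf
        with inner-vertex-neighbours (path _ _) (path-isPath _ _) t∈
               (λ { refl → ¬leaf (leaf-φ (anchor x)) }) (λ { refl → ¬leaf (leaf-φ y) })
      ... | a , b , ea , eb , a≢b , a∈ , b∈ = a , b , ea , eb , a≢b , (y , y∈ , a∈) , (y , y∈ , b∈)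

      -- A span through an internal node z leaves z along two of its three edges; if it
      -- avoids the neighbour a, those are the other two.
      span-enters-other-neighbours : {x : V} {z a y : Fin m} → ¬ Leaf 𝒯 z → Span x z →
        E z a ≡ true → ¬ Span x a → E z y ≡ true → a ≢ y → Span x y
      span-enters-other-neighbours {x} {z} {a} {y} ¬leaf Sxz eza ¬Sxa ezy a≢y
        with inner-node-of-span Sxz ¬leaf
      ... | n₁ , n₂ , e₁ , e₂ , n₁≢n₂ , Sxn₁ , Sxn₂ with n₁ ≟ y | n₂ ≟ y
      ...   | yes refl | _        = Sxn₁
      ...   | no _     | yes refl = Sxn₂
      ...   | no n₁≢y  | no n₂≢y
        with subst (4 ≤_) (ternary z ¬leaf)
               (neighbours-length≤degree E z (y ∷ a ∷ n₁ ∷ n₂ ∷ []) distinct (ezy ∷ eza ∷ e₁ ∷ e₂ ∷ []))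
        where
        distinct : Unique (y ∷ a ∷ n₁ ∷ n₂ ∷ [])
        distinct = ((a≢y ∘ sym) ∷ (n₁≢y ∘ sym) ∷ (n₂≢y ∘ sym) ∷ [])
                 ∷ ((λ { refl → ¬Sxa Sxn₁ }) ∷ (λ { refl → ¬Sxa Sxn₂ }) ∷ [])
                 ∷ (n₁≢n₂ ∷ []) ∷ [] ∷ []
      ...     | s≤s (s≤s (s≤s ()))

      separated-beyond-neighbour : {y z c w : Fin m} → ¬ Leaf 𝒯 z → E z y ≡ true → E z c ≡ true → c ≢ y →
        (Q : Walk E y w) → IsPath Q → c ∈ₗ verts Q → Σ[ x ∈ V ] (Span x y × Span x z × ¬ Span x w)
      separated-beyond-neighbour ¬leaf ezy ezc c≢y Q Q-path c∈ with edge-separated ezc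
      ... | x , Sxz , ¬Sxc = x , Sxy , Sxz ,
              λ Sxw → ¬Sxc (All.lookup (path-within (span-connected x) Q Q-path Sxy Sxw) c∈)
        where
        Sxy : Span x _
        Sxy = span-enters-other-neighbours ¬leaf Sxz ezc ¬Sxc ezy c≢y

      inner-edge-separated : {y z w : Fin m} → E z y ≡ true → (Q : Walk E y w) → IsPath Q →
        z ∈ₗ verts Q → z ≢ y → z ≢ w → Σ[ x ∈ V ] (Span x y × Span x z × ¬ Span x w)
      inner-edge-separated {y} ezy Q Q-path z∈ z≢y z≢w with inner-vertex-neighbours Q Q-path z∈ z≢y z≢w
      ... | a , b , ea , eb , a≢b , a∈ , b∈ with a ≟ y
      ...   | yes refl = separated-beyond-neighbour (distinct-neighbours⇒¬Leaf ea eb a≢b) ezy eb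
                           (λ { refl → a≢b refl }) Q Q-path b∈
      ...   | no a≢y   = separated-beyond-neighbour (distinct-neighbours⇒¬Leaf ea eb a≢b) ezy ea a≢y Q Q-path a∈

      edge-separated-from-node : {u v w : Fin m} → E u v ≡ true → w ≢ u → w ≢ v →
                                 Σ[ x ∈ V ] (Span x u × Span x v × ¬ Span x w)
      edge-separated-from-node {u} {v} {w} e w≢u w≢v with v ∈? verts (path u w)
      ... | yes v∈ = inner-edge-separated (flip-edge e) (path u w) (path-isPath u w) v∈
                       (adjacent⇒≢ e ∘ sym) (w≢v ∘ sym)
      ... | no v∉ with inner-edge-separated e (step (flip-edge e) (path u w)) (¬Any⇒All¬ _ v∉ ∷ path-isPath u w)
                         (there (start∈verts _)) (adjacent⇒≢ e) (w≢u ∘ sym)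
      ...   | x , Sxv , Sxu , ¬Sxw = x , Sxu , Sxv , ¬Sxw

      module NodeMap (B : CliqueTree G) where
        open CliqueTree B using () renaming
          (p to p′; E to E′; K to K′; isTree to isTree′; maximal to K′-maximal;
           injective to K′-injective; surjective to K′-surjective; subtree to K′-subtree)

        τ : Fin m → Fin p′
        τ t = proj₁ (K′-surjective (K t) (K-maximal t))

        K′∘τ : (t : Fin m) (x : V) → K′ (τ t) x ≡ K t x
        K′∘τ t = proj₂ (K′-surjective (K t) (K-maximal t))

        τ-unique : {r : Fin p′} {t : Fin m} → ((x : V) → K′ r x ≡ K t x) → τ t ≡ r
        τ-unique {r} {t} K′r≗Kt = K′-injective (τ t) r (λ x → trans (K′∘τ t x) (sym (K′r≗Kt x)))

        τ-injective : {s t : Fin m} → τ s ≡ τ t → s ≡ t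
        τ-injective {s} {t} τs≡τt =
          K-injective s t (λ x → trans (sym (K′∘τ s x)) (trans (cong (λ r → K′ r x) τs≡τt) (K′∘τ t x)))

        τ-surjective : (r : Fin p′) → Σ[ t ∈ Fin m ] τ t ≡ r
        τ-surjective r =
          let t , Kt≗K′r = K-surjective (K′ r) (K′-maximal r) in t , τ-unique (λ x → sym (Kt≗K′r x))

        K′-path-within : {x : V} {u v : Fin m} → Span x u → Span x v →
                         All (λ r → K′ r x ≡ true) (verts (Tree.path isTree′ (τ u) (τ v)))
        K′-path-within {x} Sxu Sxv =
          All.map (∈-tabulate⁻ _)
            (Tree.path-within isTree′ (K′-subtree x) (Tree.path isTree′ _ _) (Tree.path-isPath isTree′ _ _)
               (in-subtree Sxu) (in-subtree Sxv))
          where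
          in-subtree : {t : Fin m} → Span x t → τ t ∈ tabulate (λ r → K′ r x)
          in-subtree {t} Sxt = ∈-tabulate⁺ _ (trans (K′∘τ t x) (K-complete Sxt))

        no-node-between : {u v : Fin m} → E u v ≡ true → (r : Fin p′) →
          r ∈ₗ verts (Tree.path isTree′ (τ u) (τ v)) → r ≢ τ u → r ≢ τ v → ⊥
        no-node-between e r r∈ r≢τu r≢τv =
          let w , τw≡r             = τ-surjective r
              x , Sxu , Sxv , ¬Sxw = edge-separated-from-node e (r≢τu ∘ on-τ τw≡r) (r≢τv ∘ on-τ τw≡r)
          in ¬Sxw (K-sound (trans (sym (K′∘τ w x))
                              (subst (λ r → K′ r x ≡ true) (sym τw≡r) (All.lookup (K′-path-within Sxu Sxv) r∈))))
          where
          on-τ : {w t : Fin m} {r : Fin p′} → τ w ≡ r → w ≡ t → r ≡ τ t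
          on-τ τw≡r w≡t = trans (sym τw≡r) (cong τ w≡t)

        τ-edge : {u v : Fin m} → E u v ≡ true → E′ (τ u) (τ v) ≡ true
        τ-edge e = ¬-not λ τu≁τv →
          let r , r∈ , r≢τu , r≢τv = non-adjacent⇒inner-vertex (Tree.path isTree′ _ _) (Tree.path-isPath isTree′ _ _)
                                       (adjacent⇒≢ e ∘ τ-injective) τu≁τv
          in no-node-between e r r∈ r≢τu r≢τv

        edges-agree : (u v : Fin m) → E′ (τ u) (τ v) ≡ E u v
        edges-agree u v =
          ⇔→≡ (mk⇔ (injective-homomorphism-reflects-edges isTree isTree′ τ τ-injective τ-edge) τ-edge)

      common-preimage : (A B : CliqueTree G) (s₁ : Fin (CliqueTree.p A)) (s₂ : Fin (CliqueTree.p B)) →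
        ((x : V) → CliqueTree.K A s₁ x ≡ CliqueTree.K B s₂ x) →
        Σ[ u ∈ Fin m ] (NodeMap.τ A u ≡ s₁ × NodeMap.τ B u ≡ s₂)
      common-preimage A B s₁ s₂ s₁≗s₂ =
        let u , τu≡s₁ = NodeMap.τ-surjective A s₁
        in u , τu≡s₁ , NodeMap.τ-unique B λ x → begin
             CliqueTree.K B s₂ x              ≡⟨ s₁≗s₂ x ⟨
             CliqueTree.K A s₁ x              ≡⟨ cong (λ s → CliqueTree.K A s x) τu≡s₁ ⟨
             CliqueTree.K A (NodeMap.τ A u) x ≡⟨ NodeMap.K′∘τ A u x ⟩
             K u x                            ∎
        where open ≡-Reasoning

      uniquelyRepresentable : UniquelyRepresentable G
      uniquelyRepresentable = cliqueTree , same-edges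
        where
        same-edges : (A B : CliqueTree G) (s₁ t₁ : Fin (CliqueTree.p A)) (s₂ t₂ : Fin (CliqueTree.p B)) →
          ((x : V) → CliqueTree.K A s₁ x ≡ CliqueTree.K B s₂ x) →
          ((x : V) → CliqueTree.K A t₁ x ≡ CliqueTree.K B t₂ x) →
          CliqueTree.E A s₁ t₁ ≡ CliqueTree.E B s₂ t₂
        same-edges A B s₁ t₁ s₂ t₂ s₁≗s₂ t₁≗t₂ =
          let u , τ₁u≡s₁ , τ₂u≡s₂ = common-preimage A B s₁ s₂ s₁≗s₂
              v , τ₁v≡t₁ , τ₂v≡t₂ = common-preimage A B t₁ t₂ t₁≗t₂
          in begin
            CliqueTree.E A s₁ t₁                            ≡⟨ cong₂ (CliqueTree.E A) τ₁u≡s₁ τ₁v≡t₁ ⟨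
            CliqueTree.E A (NodeMap.τ A u) (NodeMap.τ A v)  ≡⟨ NodeMap.edges-agree A u v ⟩
            E u v                                           ≡⟨ NodeMap.edges-agree B u v ⟨
            CliqueTree.E B (NodeMap.τ B u) (NodeMap.τ B v)  ≡⟨ cong₂ (CliqueTree.E B) τ₂u≡s₂ τ₂v≡t₂ ⟩
            CliqueTree.E B s₂ t₂                            ∎
          where open ≡-Reasoning

-- The hypothesis that distinct indices carry distinct characters is not needed: a repeated
-- character only duplicates vertices of int(𝒞, 𝒯).
lemma3 : {n c : ℕ} (C : Fin c → Character n) →
    ((i j : Fin c) → i ≢ j → ¬ SamePartition (C i) (C j)) →
    (𝒯 : XTree n) (C' : Subset c) →
    ((i : Fin c) → i ∈ C' → Displays 𝒯 (C i)) →
    Free 𝒯 → Ternary 𝒯 →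
    ((u v : Fin (XTree.m 𝒯)) → XTree.E 𝒯 u v ≡ true →
      Σ[ i ∈ Fin c ] (i ∈ C' × Distinguishes 𝒯 (C i) u v)) →
    UniquelyRepresentable (IntAdj 𝒯 C)
lemma3 {n} C _ 𝒯 C' displays free ternary distinguished =
  uniquelyRepresentable edge-separated leaf-φ ternary
  where
  open XTree 𝒯
  open IntersectionGraph C 𝒯

  edge-separated : {u v : Fin m} → E u v ≡ true → Σ[ x ∈ V ] (Span x u × ¬ Span x v)
  edge-separated {u} {v} e with distinguished u v e
  ... | i , i∈C' , j , k , j≢k , u∈𝒯j , v∈𝒯k =
    (i , j) , InSpan⇒Span u∈𝒯j , λ Sxv → displays i i∈C' j k j≢k v (Span⇒InSpan Sxv , v∈𝒯k)

  leaf-φ : (y : Fin n) → Leaf 𝒯 (φ y)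
  leaf-φ y = Equivalence.from (proj₂ free (φ y)) (y , refl)
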